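{- Let $A$ be a finite set of atoms and let $\mathcal{S}\subseteq\mathcal{S}_A$ be a set of SE-interpretations that is complete and closed under here-union. Then there exists a dual-normal program $P$ with $\mathrm{at}(P)\subseteq A$ and $\mathrm{SE}(P)=\mathcal{S}$ (SE-models taken over $A$).
   Context: A rule $r$ is an expression $a_1\vee\cdots\vee a_l\leftarrow a_{l+1},\ldots,a_m,\mathit{not}\ a_{m+1},\ldots,\mathit{not}\ a_n$ with propositional atoms; $H(r)$ head atoms, $B^+(r)$, $B^-(r)$ positive/negative body atoms; a constraint has $H(r)=\emptyset$. A program is a finite set of rules; $\mathrm{at}(P)$ its atoms. A set $I$ of atoms satisfies $r$ if $(H(r)\cup B^-(r))\cap I\neq\emptyset$ or $B^+(r)\setminus I\neq\emptyset$; a model satisfies all rules. Reduct: $P^I=\{H(r)\leftarrow B^+(r)\mid r\in P, I\cap B^-(r)=\emptyset\}$. $P$ is dual-normal if every rule is a constraint or has $|B^+(r)|\le1$. An SE-interpretation is a pair $(X,Y)$ with $X\subseteq Y$; $\mathcal{S}_A=\{(X,Y)\mid X\subseteq Y\subseteq A\}$. $(X,Y)$ is an SE-model of $P$ if $Y$ is a model of $P$ and $X$ a model of $P^Y$; $\mathrm{SE}(P)$ denotes the set of SE-models of $P$ in $\mathcal{S}_A$. $\mathcal{S}$ is complete if (1) $(X,Y)\in\mathcal{S}$ implies $(Y,Y)\in\mathcal{S}$, and (2) $(X,Y),(Z,Z)\in\mathcal{S}$ and $Y\subseteq Z$ imply $(X,Z)\in\mathcal{S}$. It is closed under here-union if $(X,Y),(X',Y)\in\mathcal{S}$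 implies $(X\cup X',Y)\in\mathcal{S}$. -}

module Defs where

open import Data.Nat using (ℕ; _≤_)
open import Data.Fin using (Fin)
open import Data.Fin.Subset using (Subset; _∈_; _∉_; _⊆_; _∪_)
open import Data.List using (List; []; length)
open import Data.List.Relation.Unary.All using (All)
open import Data.List.Relation.Unary.Any using (Any)
open import Data.Bool using (Bool; true)
open import Data.Product using (_×_)
open import Data.Sum using (_⊎_)
open import Relation.Binary.PropositionalEquality using (_≡_)

-- Atoms are the elements of a finite set A, represented as Fin n
-- (any finite set of atoms is in bijection with some Fin n).
-- An interpretation is a subset of the atoms.

-- A rule  a₁ ∨ … ∨ aₗ ← aₗ₊₁,…,aₘ, not aₘ₊₁,…,not aₙ  over atoms Fin n.
-- A constraint is a rule with empty head list.
record Rule (n : ℕ) : Set where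
  constructor _⇐_∣_
  field
    H    : List (Fin n)
    Bpos : List (Fin n)
    Bneg : List (Fin n)
open Rule public

-- A program is a finite collection of rules; at(P) ⊆ A holds by typing.
Program : ℕ → Set
Program n = List (Rule n)

Satisfies : ∀ {n} → Subset n → Rule n → Set
Satisfies I r = Any (_∈ I) (H r) ⊎ Any (_∈ I) (Bneg r) ⊎ Any (_∉ I) (Bpos r)

IsModel : ∀ {n} → Subset n → Program n → Set
IsModel I P = All (Satisfies I) P

-- Reduct P^I = { H(r) ← B⁺(r) | r ∈ P, I ∩ B⁻(r) = ∅ }.
-- X is a model of P^I iff for every r ∈ P with I ∩ B⁻(r) = ∅, X satisfies H(r) ← B⁺(r).
ReductRule : ∀ {n} → Rule n → Rule n
ReductRule r = H r ⇐ Bpos r ∣ []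

IsModelOfReduct : ∀ {n} → Subset n → Subset n → Program n → Set
IsModelOfReduct X I P =
  All (λ r → All (_∉ I) (Bneg r) → Satisfies X (ReductRule r)) P

IsConstraint : ∀ {n} → Rule n → Set
IsConstraint r = H r ≡ []

DualNormal : ∀ {n} → Program n → Set
DualNormal P = All (λ r → IsConstraint r ⊎ length (Bpos r) ≤ 1) P

IsSEModel : ∀ {n} → Program n → Subset n → Subset n → Set
IsSEModel P X Y = X ⊆ Y × IsModel Y P × IsModelOfReduct X Y P

-- A set 𝒮 of SE-interpretations over A = Fin n is given by its characteristic
-- function (every subset of the finite set 𝒮_A is decidable classically).
SESet : ℕ → Set
SESet n = Subset n → Subset n → Bool

_∋ₛ_,_ : ∀ {n} → SESet n → Subset n → Subset n → Set
S ∋ₛ X , Y = S X Y ≡ true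

WithinSA : ∀ {n} → SESet n → Set
WithinSA S = ∀ X Y → S ∋ₛ X , Y → X ⊆ Y

Complete : ∀ {n} → SESet n → Set
Complete S =
  (∀ X Y → S ∋ₛ X , Y → S ∋ₛ Y , Y) ×
  (∀ X Y Z → S ∋ₛ X , Y → S ∋ₛ Z , Z → Y ⊆ Z → S ∋ₛ X , Z)

ClosedUnderHereUnion : ∀ {n} → SESet n → Set
ClosedUnderHereUnion S =
  ∀ X X′ Y → S ∋ₛ X , Y → S ∋ₛ X′ , Y → S ∋ₛ (X ∪ X′) , Y

module Submission where

-- For X, Y ⊆ A and an optional atom b, consider the
-- candidate rules
--     κ(Y)     =          ← Y, not (A∖Y)        (a constraint),
--     ρ(X,Y,b) =  (Y∖X)   ← b, not (A∖Y)        (positive body of length ≤ 1),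
-- all of which are dual-normal.  The canonical program of a list C of rules keeps those r ∈ C that
-- 𝒮 respects: X ⊨ r^Y for every (X,Y) ∈ 𝒮 for which r survives the reduct.  For every C and every
-- 𝒮 ⊆ 𝒮_A satisfying completeness (1) we get 𝒮 ⊆ SE(P); and SE(P) ⊆ 𝒮 as soon as C separates 𝒮,
-- i.e. every (X,Y) ∉ 𝒮 is refuted by some respected r ∈ C.  Separation is where the hypotheses enter:
--   * if (Y,Y) ∉ 𝒮, then κ(Y) is respected (by completeness (1)) and Y violates it;
--   * if (Y,Y) ∈ 𝒮, then X violates the reduct of every ρ(X,Y,b) with b ∈ {none} ∪ X.  If 𝒮 violated
--     all of them, completeness (2) would turn the violators into sets Z ⊆ X with (Z,Y) ∈ 𝒮 that
--     cover X, and their here-union gives (X,Y) ∈ 𝒮.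

open import Defs
open import Level using (0ℓ)
open import Function using (id; _∘_)
open import Data.Nat using (ℕ; zero; suc; _≤_; z≤n; s≤s)
open import Data.Fin using (Fin)
open import Data.Fin.Subset using (Subset; _∈_; _∉_; _⊆_; _∪_; inside; outside)
open import Data.Fin.Subset.Properties
  using (_∈?_; anySubset?; ⊆-antisym; ⊆-trans; p⊆p∪q; q⊆p∪q; x∈p∪q⁻)
open import Data.Product using (Σ; _×_; _,_; proj₁; proj₂; ∃; ∃-syntax)
open import Data.Sum using (_⊎_; inj₁; inj₂; [_,_]′)
open import Data.Maybe using (Maybe; nothing; just)
open import Data.Bool using (true; _≟_)
open import Data.Empty using (⊥-elim)
import Data.Vec as Vec
open import Data.List
  using (List; []; _∷_; _++_; map; filter; allFin; length; fromMaybe; cartesianProduct; cartesianProductWith)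
open import Data.List.Relation.Unary.All as All using (All; []; _∷_; all?)
open import Data.List.Relation.Unary.Any as Any using (here; any?)
open import Data.List.Relation.Unary.All.Properties
  using (all-filter; filter⁺; map⁺; ¬Any⇒All¬; All¬⇒¬Any; ¬All⇒Any¬)
open import Data.List.Membership.Propositional using (find) renaming (_∈_ to _∈L_)
open import Data.List.Membership.Propositional.Properties
  using (∈-filter⁺; ∈-filter⁻; ∈-allFin; ∈-map⁺; ∈-++⁺ˡ; ∈-++⁺ʳ;
         ∈-cartesianProduct⁺; ∈-cartesianProductWith⁺)
open import Relation.Nullary using (¬_; Dec; yes; no; ¬?)
open import Relation.Nullary.Decidable using (_×-dec_; _⊎-dec_; decidable-stable)
open import Relation.Unary using (Pred; Decidable)
open import Relation.Binary.PropositionalEquality using (_≡_; refl; subst)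
open import Function.Bundles using (_⇔_; mk⇔)

subsets : (m : ℕ) → List (Subset m)
subsets zero    = Vec.[] ∷ []
subsets (suc m) = map (inside Vec.∷_) (subsets m) ++ map (outside Vec.∷_) (subsets m)

∈-subsets : ∀ {m} (Z : Subset m) → Z ∈L subsets m
∈-subsets Vec.[]            = here refl
∈-subsets (inside Vec.∷ Z)  = ∈-++⁺ˡ (∈-map⁺ (inside Vec.∷_) (∈-subsets Z))
∈-subsets (outside Vec.∷ Z) = ∈-++⁺ʳ _ (∈-map⁺ (outside Vec.∷_) (∈-subsets Z))

module _ {n : ℕ} where

  atomsWhere : {P : Pred (Fin n) 0ℓ} → Decidable P → List (Fin n)
  atomsWhere P? = filter P? (allFin n)

  atomsWhere-complete : {P : Pred (Fin n) 0ℓ} (P? : Decidable P) {x : Fin n} → P x → x ∈L atomsWhere P?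
  atomsWhere-complete P? {x} = ∈-filter⁺ P? (∈-allFin x)

  atomsWhere-sound : {P : Pred (Fin n) 0ℓ} (P? : Decidable P) → All P (atomsWhere P?)
  atomsWhere-sound P? = all-filter P? (allFin n)

  elements : Subset n → List (Fin n)
  elements Y = atomsWhere (_∈? Y)

  complementOf : Subset n → List (Fin n)
  complementOf Y = atomsWhere (λ x → ¬? (x ∈? Y))

  difference : Subset n → Subset n → List (Fin n)
  difference Y X = atomsWhere (λ x → x ∈? Y ×-dec ¬? (x ∈? X))

  -- Z avoids the atoms outside Y exactly when Z ⊆ Y; this is how `not (A∖Y)' encodes Y.
  avoids-complement⇒⊆ : ∀ {Y Z : Subset n} → All (_∉ Z) (complementOf Y) → Z ⊆ Y
  avoids-complement⇒⊆ {Y} avoid {x} x∈Z =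
    decidable-stable (x ∈? Y) (λ x∉Y → All.lookup avoid (atomsWhere-complete _ x∉Y) x∈Z)

  ⊆⇒avoids-complement : ∀ {Y Z : Subset n} → Z ⊆ Y → All (_∉ Z) (complementOf Y)
  ⊆⇒avoids-complement Z⊆Y = All.map (λ x∉Y x∈Z → x∉Y (Z⊆Y x∈Z)) (atomsWhere-sound _)

  ∪-⊆ : ∀ {Z W X : Subset n} → Z ⊆ X → W ⊆ X → Z ∪ W ⊆ X
  ∪-⊆ {Z} {W} Z⊆X W⊆X = [ Z⊆X , W⊆X ]′ ∘ x∈p∪q⁻ Z W

  Active : Subset n → Rule n → Set
  Active Y r = All (_∉ Y) (Bneg r)

  satisfies? : ∀ (I : Subset n) r → Dec (Satisfies I r)
  satisfies? I r =
    any? (_∈? I) (H r) ⊎-dec any? (_∈? I) (Bneg r) ⊎-dec any? (λ x → ¬? (x ∈? I)) (Bpos r)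

  reduct⇒rule : ∀ {I : Subset n} r → Satisfies I (ReductRule r) → Satisfies I r
  reduct⇒rule r (inj₁ head)           = inj₁ head
  reduct⇒rule r (inj₂ (inj₁ ()))
  reduct⇒rule r (inj₂ (inj₂ missing)) = inj₂ (inj₂ missing)

  violates-reduct⇒ : ∀ {I : Subset n} r → ¬ Satisfies I (ReductRule r) →
                     All (_∉ I) (H r) × All (_∈ I) (Bpos r)
  violates-reduct⇒ {I} r v =
    ¬Any⇒All¬ _ (v ∘ inj₁) , All.map (decidable-stable (_ ∈? I)) (¬Any⇒All¬ _ (v ∘ inj₂ ∘ inj₂))

  violates-reduct⇐ : ∀ {I : Subset n} r → All (_∉ I) (H r) → All (_∈ I) (Bpos r) →
                     ¬ Satisfies I (ReductRule r)
  violates-reduct⇐ r noHead body (inj₁ head)           = All¬⇒¬Any noHead head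
  violates-reduct⇐ r noHead body (inj₂ (inj₂ missing)) =
    All¬⇒¬Any (All.map (λ x∈I x∉I → x∉I x∈I) body) missing

  Refutes : Subset n → Subset n → Rule n → Set
  Refutes X Y r = ¬ Satisfies Y r ⊎ (Active Y r × ¬ Satisfies X (ReductRule r))

  SE-model-¬refutes : ∀ {P : Program n} {X Y r} → IsSEModel P X Y → r ∈L P → ¬ Refutes X Y r
  SE-model-¬refutes (_ , model , _) r∈P (inj₁ v)          = v (All.lookup model r∈P)
  SE-model-¬refutes (_ , _ , reduct) r∈P (inj₂ (act , v)) = v (All.lookup reduct r∈P act)

  κ : Subset n → Rule n
  κ Y = [] ⇐ elements Y ∣ complementOf Y

  κ-refutes-self : ∀ Y → ¬ Satisfies Y (κ Y)
  κ-refutes-self Y (inj₂ (inj₁ blocked)) = All¬⇒¬Any (⊆⇒avoids-complement id) blocked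
  κ-refutes-self Y (inj₂ (inj₂ missing)) =
    All¬⇒¬Any (All.map (λ x∈Y x∉Y → x∉Y x∈Y) (atomsWhere-sound _)) missing

  κ-violator : ∀ {Y Z} → ¬ Satisfies Z (ReductRule (κ Y)) → Y ⊆ Z
  κ-violator {Y} v x∈Y = All.lookup (proj₂ (violates-reduct⇒ (κ Y) v)) (atomsWhere-complete _ x∈Y)

  ρ : Subset n → Subset n → Maybe (Fin n) → Rule n
  ρ X Y b = difference Y X ⇐ fromMaybe b ∣ complementOf Y

  ρ-refutes : ∀ {X Y} b → All (_∈ X) (fromMaybe b) → ¬ Satisfies X (ReductRule (ρ X Y b))
  ρ-refutes {X} {Y} b b∈X = violates-reduct⇐ (ρ X Y b) (All.map proj₂ (atomsWhere-sound _)) b∈X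

  ρ-violator : ∀ {X Y Z} b → Z ⊆ Y → ¬ Satisfies Z (ReductRule (ρ X Y b)) →
               Z ⊆ X × All (_∈ Z) (fromMaybe b)
  ρ-violator {X} {Y} {Z} b Z⊆Y v = Z⊆X , proj₂ violated
    where
      violated : All (_∉ Z) (difference Y X) × All (_∈ Z) (fromMaybe b)
      violated = violates-reduct⇒ (ρ X Y b) v
      Z⊆X : Z ⊆ X
      Z⊆X {x} x∈Z = decidable-stable (x ∈? X)
        (λ x∉X → All.lookup (proj₁ violated) (atomsWhere-complete _ (Z⊆Y x∈Z , x∉X)) x∈Z)

  -- Names of the candidate rules, so that dual-normality can be checked name by name.
  data Candidate : Set where
    constraintFor : Subset n → Candidate
    ruleFor       : Subset n → Subset n → Maybe (Fin n) → Candidate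

  toRule : Candidate → Rule n
  toRule (constraintFor Y) = κ Y
  toRule (ruleFor X Y b)   = ρ X Y b

  toRule-dualNormal : ∀ c → IsConstraint (toRule c) ⊎ length (Bpos (toRule c)) ≤ 1
  toRule-dualNormal (constraintFor Y)     = inj₁ refl
  toRule-dualNormal (ruleFor X Y nothing) = inj₂ z≤n
  toRule-dualNormal (ruleFor X Y (just a)) = inj₂ (s≤s z≤n)

  bodies : List (Maybe (Fin n))
  bodies = nothing ∷ map just (allFin n)

  ∈-bodies : ∀ b → b ∈L bodies
  ∈-bodies nothing  = here refl
  ∈-bodies (just a) = ∈-++⁺ʳ (nothing ∷ []) (∈-map⁺ just (∈-allFin a))

  candidates : List Candidate
  candidates =
    map constraintFor (subsets n) ++
    cartesianProductWith (λ (X , Y) b → ruleFor X Y b) (cartesianProduct (subsets n) (subsets n)) bodies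

  ∈-candidates : ∀ c → c ∈L candidates
  ∈-candidates (constraintFor Y) = ∈-++⁺ˡ (∈-map⁺ constraintFor (∈-subsets Y))
  ∈-candidates (ruleFor X Y b)   = ∈-++⁺ʳ (map constraintFor (subsets n))
    (∈-cartesianProductWith⁺ _ (∈-cartesianProduct⁺ (∈-subsets X) (∈-subsets Y)) (∈-bodies b))

  candidateRules : List (Rule n)
  candidateRules = map toRule candidates

  ∈-candidateRules : ∀ c → toRule c ∈L candidateRules
  ∈-candidateRules c = ∈-map⁺ toRule (∈-candidates c)

  candidateRules-dualNormal : DualNormal candidateRules
  candidateRules-dualNormal = map⁺ (All.universal toRule-dualNormal candidates)

module Canonical {n : ℕ} (S : SESet n) where

  Violator : Rule n → Set
  Violator r = ∃[ X ] ∃[ Y ] S ∋ₛ X , Y × Active Y r × ¬ Satisfies X (ReductRule r)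

  violator? : Decidable Violator
  violator? r = anySubset? λ X → anySubset? λ Y →
    (S X Y ≟ true) ×-dec all? (λ x → ¬? (x ∈? Y)) (Bneg r) ×-dec ¬? (satisfies? X (ReductRule r))

  -- 𝒮 respects r: every member of 𝒮 satisfies r in the SE sense (given completeness (1)).
  Respected : Rule n → Set
  Respected r = ¬ Violator r

  canonical : List (Rule n) → Program n
  canonical C = filter (λ r → ¬? (violator? r)) C

  respected-reduct : ∀ {r X Y} → Respected r → S ∋ₛ X , Y → Active Y r → Satisfies X (ReductRule r)
  respected-reduct resp s act = decidable-stable (satisfies? _ _) (λ v → resp (_ , _ , s , act , v))

  respected-model : ∀ {r Y} → Respected r → S ∋ₛ Y , Y → Satisfies Y r
  respected-model {r} {Y} resp s with all? (λ x → ¬? (x ∈? Y)) (Bneg r)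
  ... | yes act     = reduct⇒rule r (respected-reduct resp s act)
  ... | no blocked  =
    inj₂ (inj₁ (Any.map (decidable-stable (_ ∈? Y)) (¬All⇒Any¬ (λ x → ¬? (x ∈? Y)) (Bneg r) blocked)))

  canonical-respected : ∀ C {r} → r ∈L canonical C → Respected r
  canonical-respected C r∈ = proj₂ (∈-filter⁻ (λ r → ¬? (violator? r)) {xs = C} r∈)

  canonical-sound : ∀ C {X Y} → WithinSA S → (∀ X Y → S ∋ₛ X , Y → S ∋ₛ Y , Y) →
                    S ∋ₛ X , Y → IsSEModel (canonical C) X Y
  canonical-sound C within total s =
    within _ _ s ,
    All.tabulate (λ r∈ → respected-model (canonical-respected C r∈) (total _ _ s)) ,
    All.tabulate (λ r∈ → respected-reduct (canonical-respected C r∈) s)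

  Separates : List (Rule n) → Set
  Separates C = ∀ X Y → ¬ (S ∋ₛ X , Y) → ∃[ r ] r ∈L C × Respected r × Refutes X Y r

  canonical-exact : ∀ C {X Y} → Separates C → IsSEModel (canonical C) X Y → S ∋ₛ X , Y
  canonical-exact C {X} {Y} sep se = decidable-stable (S X Y ≟ true) λ X,Y∉S →
    let r , r∈C , resp , refutes = sep X Y X,Y∉S
    in SE-model-¬refutes se (∈-filter⁺ (λ r → ¬? (violator? r)) r∈C resp) refutes

  Below : Subset n → Subset n → Subset n → Set
  Below X Y Z = Z ⊆ X × S ∋ₛ Z , Y

  union-of-witnesses : ClosedUnderHereUnion S → ∀ {X Y} → ∃ (Below X Y) → (L : List (Fin n)) →
                       All (λ a → ∃[ Z ] Below X Y Z × a ∈ Z) L → ∃[ Z ] Below X Y Z × All (_∈ Z) L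
  union-of-witnesses huc (Z , below) [] [] = Z , below , []
  union-of-witnesses huc base (a ∷ L) ((W , (W⊆X , sW) , a∈W) ∷ rest) =
    let Z , (Z⊆X , sZ) , covered = union-of-witnesses huc base L rest
    in W ∪ Z , (∪-⊆ W⊆X Z⊆X , huc W Z _ sW sZ) , p⊆p∪q Z a∈W ∷ All.map (q⊆p∪q W Z) covered

module Separation {n : ℕ} (S : SESet n) (within : WithinSA S) (comp : Complete S)
                  (huc : ClosedUnderHereUnion S) where
  open Canonical S

  -- A violator (Z,Y′) of κ(Y) has Y ⊆ Z ⊆ Y′ ⊆ Y, so completeness (1) would put (Y,Y) in 𝒮.
  κ-respected : ∀ {Y : Subset n} → ¬ (S ∋ₛ Y , Y) → Respected (κ Y)
  κ-respected {Y} Y,Y∉S (Z , Y′ , s , act , v) =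
    Y,Y∉S (subst (λ W → S ∋ₛ W , W) Y′≡Y (proj₁ comp Z Y′ s))
    where
      Y′≡Y : Y′ ≡ Y
      Y′≡Y = ⊆-antisym (avoids-complement⇒⊆ act) (⊆-trans (κ-violator v) (within Z Y′ s))

  ρ-witness : ∀ {X Y : Subset n} b → S ∋ₛ Y , Y → Violator (ρ X Y b) →
              ∃[ Z ] Below X Y Z × All (_∈ Z) (fromMaybe b)
  ρ-witness {Y = Y} b sY (Z , Y′ , s , act , v) =
    let Y′⊆Y = avoids-complement⇒⊆ act
        Z⊆X , body = ρ-violator b (⊆-trans (within Z Y′ s) Y′⊆Y) v
    in Z , (Z⊆X , proj₂ comp Z Y′ Y s sY Y′⊆Y) , body

  all-violated⇒member : ∀ {X Y : Subset n} → S ∋ₛ Y , Y → Violator (ρ X Y nothing) →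
                        All (λ a → Violator (ρ X Y (just a))) (elements X) → S ∋ₛ X , Y
  all-violated⇒member {X} {Y} sY v₀ vs =
    let Z , (Z⊆X , sZ) , covered = union-of-witnesses huc base (elements X) (All.map witness vs)
        X⊆Z : X ⊆ Z
        X⊆Z x∈X = All.lookup covered (atomsWhere-complete _ x∈X)
    in subst (λ W → S ∋ₛ W , Y) (⊆-antisym Z⊆X X⊆Z) sZ
    where
      base : ∃ (Below X Y)
      base = let Z , below , _ = ρ-witness nothing sY v₀ in Z , below
      witness : ∀ {a} → Violator (ρ X Y (just a)) → ∃[ Z ] Below X Y Z × a ∈ Z
      witness {a} v = let Z , below , a∈Z = ρ-witness (just a) sY v in Z , below , All.head a∈Z

  ρ-refuted : ∀ (X Y : Subset n) b → All (_∈ X) (fromMaybe b) → Refutes X Y (ρ X Y b)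
  ρ-refuted X Y b b∈X = inj₂ (⊆⇒avoids-complement {Y = Y} id , ρ-refutes {X = X} {Y = Y} b b∈X)

  separates : Separates candidateRules
  separates X Y X,Y∉S with S Y Y ≟ true
  ... | no Y,Y∉S =
    κ Y , ∈-candidateRules (constraintFor Y) , κ-respected Y,Y∉S , inj₁ (κ-refutes-self Y)
  ... | yes sY with violator? (ρ X Y nothing)
  ...   | no resp = ρ X Y nothing , ∈-candidateRules (ruleFor X Y nothing) , resp , ρ-refuted X Y nothing []
  ...   | yes v₀ with all? (λ a → violator? (ρ X Y (just a))) (elements X)
  ...     | yes vs = ⊥-elim (X,Y∉S (all-violated⇒member {X} {Y} sY v₀ vs))
  ...     | no someRespected =
    let a , a∈X , resp = find (¬All⇒Any¬ (λ a → violator? (ρ X Y (just a))) _ someRespected)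
    in ρ X Y (just a) , ∈-candidateRules (ruleFor X Y (just a)) , resp ,
       ρ-refuted X Y (just a) (All.lookup (atomsWhere-sound (_∈? X)) a∈X ∷ [])

theorem6 : (n : ℕ) (S : SESet n) → WithinSA S → Complete S → ClosedUnderHereUnion S →
    Σ (Program n) λ P → DualNormal P × (∀ (X Y : Subset n) → (IsSEModel P X Y ⇔ (S ∋ₛ X , Y)))
theorem6 n S within comp huc =
  canonical candidateRules ,
  filter⁺ _ candidateRules-dualNormal ,
  λ X Y → mk⇔ (canonical-exact candidateRules separates)
              (canonical-sound candidateRules within (proj₁ comp))
  where
    open Canonical S
    open Separation S within comp huc
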